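{- Let $q$ be a prime power, $n\ge 2$, and let $U\subsetneq \mathbb{F}_{q^n}$ be an $\mathbb{F}_q$-vector space of dimension $d_U\ge 1$. Then $\omega(G_U)\ge 3$. Moreover, if $U$ contains a nonzero square of $\mathbb{F}_{q^n}$, then $\omega(G_U)\ge q+\min\{1,d_U-1\}$; otherwise $\omega(G_U)=3$.
   Context: For an $\mathbb{F}_q$-vector subspace $U\subsetneq \mathbb{F}_{q^n}$, $G_U$ is the undirected graph with vertex set $\mathbb{F}_{q^n}$ in which distinct $a,b$ are adjacent if and only if $ab\in U$; $d_U$ is the $\mathbb{F}_q$-dimension of $U$ and $\omega(G_U)$ is the clique number of $G_U$. A nonzero square is an element $b^2$ with $b\in\mathbb{F}_{q^n}^*$. -}

module Defs where

open import Level using (Level; _⊔_) renaming (suc to lsuc)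
open import Data.Nat using (ℕ; zero; suc; _≤_; _^_)
open import Data.Nat.Primality using (Prime)
open import Data.Fin using (Fin; zero; suc)
open import Data.Product using (Σ; ∃; ∃-syntax; _×_; _,_)
open import Relation.Nullary using (¬_)
open import Relation.Unary using (Pred)
open import Relation.Binary.PropositionalEquality using (_≡_; _≢_)
open import Algebra.Bundles using (CommutativeRing)

IsPrimePower : ℕ → Set
IsPrimePower q = Σ ℕ λ p → Σ ℕ λ m → Prime p × 1 ≤ m × q ≡ p ^ m

record Field (c ℓ : Level) : Set (lsuc (c ⊔ ℓ)) where
  field
    commutativeRing : CommutativeRing c ℓ
  open CommutativeRing commutativeRing public
  field
    1≉0     : ¬ (1# ≈ 0#)
    inverse : ∀ x → ¬ (x ≈ 0#) → ∃[ y ] (x * y ≈ 1#)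

module _ {c ℓ : Level} (K : Field c ℓ) where
  open Field K using (Carrier; _≈_; _+_; _*_; -_; 0#; 1#)

  HasCard : ℕ → Set (c ⊔ ℓ)
  HasCard N = Σ (Fin N → Carrier) λ f →
                (∀ i j → f i ≈ f j → i ≡ j) × (∀ x → ∃[ i ] (f i ≈ x))

  SubsetCard : ∀ {p} → Pred Carrier p → ℕ → Set (c ⊔ ℓ ⊔ p)
  SubsetCard S N = Σ (Fin N → Carrier) λ f →
                     (∀ i → S (f i)) × (∀ i j → f i ≈ f j → i ≡ j)
                     × (∀ x → S x → ∃[ i ] (f i ≈ x))

  record IsSubfield {p} (F : Pred Carrier p) : Set (c ⊔ ℓ ⊔ p) where
    field
      resp  : ∀ {x y} → x ≈ y → F x → F y
      has0  : F 0#
      has1  : F 1#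
      +-cl  : ∀ {x y} → F x → F y → F (x + y)
      neg-cl : ∀ {x} → F x → F (- x)
      *-cl  : ∀ {x y} → F x → F y → F (x * y)
      inv-cl : ∀ {x y} → F x → x * y ≈ 1# → F y

  record IsSubspace {p r} (F : Pred Carrier p) (U : Pred Carrier r) : Set (c ⊔ ℓ ⊔ p ⊔ r) where
    field
      resp  : ∀ {x y} → x ≈ y → U x → U y
      has0  : U 0#
      +-cl  : ∀ {x y} → U x → U y → U (x + y)
      smul-cl : ∀ {a x} → F a → U x → U (a * x)

  Proper : ∀ {r} → Pred Carrier r → Set (c ⊔ r)
  Proper U = ∃[ x ] (¬ U x)

  lincomb : ∀ {d} → (Fin d → Carrier) → (Fin d → Carrier) → Carrier
  lincomb {zero}  cs bs = 0#
  lincomb {suc d} cs bs = cs zero * bs zero + lincomb (λ i → cs (suc i)) (λ i → bs (suc i))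

  HasDim : ∀ {p r} → Pred Carrier p → Pred Carrier r → ℕ → Set (c ⊔ ℓ ⊔ p ⊔ r)
  HasDim F U d = Σ (Fin d → Carrier) λ b →
      (∀ i → U (b i))
    × (∀ (cs : Fin d → Carrier) → (∀ i → F (cs i)) → lincomb cs b ≈ 0# → ∀ i → cs i ≈ 0#)
    × (∀ x → U x → Σ (Fin d → Carrier) λ cs → (∀ i → F (cs i)) × (x ≈ lincomb cs b))

  -- a clique of size k in G_U: k distinct elements with pairwise products in U
  IsClique : ∀ {r} → Pred Carrier r → (k : ℕ) → (Fin k → Carrier) → Set (ℓ ⊔ r)
  IsClique U k v = (∀ i j → v i ≈ v j → i ≡ j) × (∀ i j → i ≢ j → U (v i * v j))

  CliqueNumber≥ : ∀ {r} → Pred Carrier r → ℕ → Set (c ⊔ ℓ ⊔ r)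
  CliqueNumber≥ U k = ∃[ v ] IsClique U k v

  CliqueNumber≡ : ∀ {r} → Pred Carrier r → ℕ → Set (c ⊔ ℓ ⊔ r)
  CliqueNumber≡ U k = CliqueNumber≥ U k × ¬ CliqueNumber≥ U (suc k)

  HasNonzeroSquare : ∀ {r} → Pred Carrier r → Set (c ⊔ ℓ ⊔ r)
  HasNonzeroSquare U = ∃[ b ] (¬ (b ≈ 0#) × U (b * b))

{-# OPTIONS --safe #-}
-- The vertex 0 is adjacent to every vertex. A nonzero u ∈ U gives the triangle
-- {0, 1, u}, or {0, x, x⁻¹} for any x ∉ U when u = 1. If b ≠ 0 and b² ∈ U, the
-- set b F is a q-clique; when d_U ≥ 2 some w ∈ U lies off the line F b², and w / b
-- extends it. If U contains no nonzero square, a 4-clique has three nonzero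
-- vertices whose pairwise products are non-squares in U, and any two of these
-- products multiply to a square times the third: three distinct square classes.
-- Counting the values c t² over the three classes c and all t, each hit at most
-- twice by t ≠ 0, gives 3 N ≤ 2 N + 3, impossible for N = q^n ≥ 4.
module Submission where

open import Defs
open import Level using (Level; _⊔_)
open import Data.Nat using (ℕ; zero; suc; _≤_; _<_; _∸_; _⊓_; _^_)
open import Relation.Unary using (Pred)
import Data.Nat as ℕ
import Data.Nat.Properties as ℕ
open import Data.Nat.Primality using (prime⇒nonZero; prime⇒nonTrivial)
open import Data.Fin using (Fin; zero; suc; punchIn)
import Data.Fin.Properties as Fin
open import Data.Vec.Functional using ([]; _∷_)
open import Data.Bool using (Bool)
open import Data.Product using (_×_; ∃-syntax; _,_; proj₁; proj₂)
open import Data.Product.Properties using (,-injective)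
open import Data.Product.Function.NonDependent.Propositional using (_×-↔_)
open import Data.Sum using (_⊎_; inj₁; inj₂; [_,_]′)
open import Data.Sum.Properties using (inj₁-injective; inj₂-injective)
open import Data.Sum.Function.Propositional using (_⊎-↔_)
open import Data.Empty using (⊥; ⊥-elim)
open import Function using (_∘_; _↔_; _↣_; Injection; mk↣)
open import Function.Properties.Inverse using (↔-refl; ↔-sym; ↔⇒↣)
open import Function.Construct.Composition using (_↔-∘_; _↣-∘_)
open import Function.Definitions using (Injective)
open import Relation.Nullary using (¬_; Dec; yes; no; does)
open import Relation.Binary.Definitions using (Decidable)
open import Relation.Binary.PropositionalEquality
  using (_≡_; _≢_; refl; cong; cong₂; subst; subst₂)
  renaming (sym to ≡-sym; trans to ≡-trans)
import Algebra.Properties.AbelianGroup as AbelianGroupProperties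
import Algebra.Properties.Ring as RingProperties
import Algebra.Solver.CommutativeMonoid as CommutativeMonoidSolver

primePower⇒2≤ : ∀ {q} → IsPrimePower q → 2 ≤ q
primePower⇒2≤ (p , m , p-prime , 1≤m , refl) = ℕ.≤-trans 2≤p p≤p^m
  where
    2≤p : 2 ≤ p
    2≤p = ℕ.nonTrivial⇒n>1 p {{prime⇒nonTrivial p-prime}}
    p≤p^m : p ≤ p ^ m
    p≤p^m = subst (_≤ p ^ m) (ℕ.^-identityʳ p) (ℕ.^-monoʳ-≤ p {{prime⇒nonZero p-prime}} 1≤m)

4≤m^n : ∀ {m n} → 2 ≤ m → 2 ≤ n → 4 ≤ m ^ n
4≤m^n {m} {n} 2≤m 2≤n = ℕ.≤-trans (ℕ.^-monoʳ-≤ 2 2≤n) (ℕ.^-monoˡ-≤ n 2≤m)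

does-transport : ∀ {a b} {A : Set a} {B : Set b} (a? : Dec A) (b? : Dec B) → does a? ≡ does b? → A → B
does-transport (yes _) (yes b) _  _ = b
does-transport (yes _) (no _)  () _
does-transport (no ¬a) _       _  a = ⊥-elim (¬a a)

≤?-flip : ∀ {n} {i j : Fin n} → i ≢ j → does (i Fin.≤? j) ≢ does (j Fin.≤? i)
≤?-flip {i = i} {j} i≢j eq with Fin.≤-total i j
... | inj₁ i≤j = i≢j (Fin.≤-antisym i≤j (does-transport (i Fin.≤? j) (j Fin.≤? i) eq i≤j))
... | inj₂ j≤i = i≢j (Fin.≤-antisym (does-transport (j Fin.≤? i) (i Fin.≤? j) (≡-sym eq) j≤i) j≤i)

module FieldProperties {c ℓ} (K : Field c ℓ) where
  open Field K renaming (refl to ≈-refl; zero to *-zero)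
  open import Relation.Binary.Reasoning.Setoid setoid
  open AbelianGroupProperties +-abelianGroup
    using (⁻¹-selfInverse; inverseˡ-unique; x≈y⇒x∙y⁻¹≈ε; x∙y⁻¹≈ε⇒x≈y)
  open RingProperties ring using (x[y-z]≈xy-xz)
  open CommutativeMonoidSolver *-commutativeMonoid using (solve; _⊜_; _⊕_)

  IsSquare : Carrier → Set (c ⊔ ℓ)
  IsSquare z = ∃[ s ] s * s ≈ z

  IsSquare-resp : ∀ {x y} → x ≈ y → IsSquare x → IsSquare y
  IsSquare-resp x≈y (s , s²≈x) = s , trans s²≈x x≈y

  neg-swap : ∀ {x y} → x ≈ - y → y ≈ - x
  neg-swap x≈-y = sym (⁻¹-selfInverse (sym x≈-y))

  inv : ∀ x → ¬ x ≈ 0# → Carrier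
  inv x x≉0 = proj₁ (inverse x x≉0)

  *-inverseʳ : ∀ x (x≉0 : ¬ x ≈ 0#) → x * inv x x≉0 ≈ 1#
  *-inverseʳ x x≉0 = proj₂ (inverse x x≉0)

  inv-nonzero : ∀ x (x≉0 : ¬ x ≈ 0#) → ¬ inv x x≉0 ≈ 0#
  inv-nonzero x x≉0 u≈0 =
    1≉0 (trans (sym (*-inverseʳ x x≉0)) (trans (*-congˡ u≈0) (zeroʳ x)))

  *-cancelˡ : ∀ {a x y} → ¬ a ≈ 0# → a * x ≈ a * y → x ≈ y
  *-cancelˡ {a} {x} {y} a≉0 ax≈ay = begin
    x                   ≈⟨ *-identityˡ x ⟨
    1# * x              ≈⟨ *-congʳ (trans (*-comm u a) (*-inverseʳ a a≉0)) ⟨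
    (u * a) * x         ≈⟨ *-assoc u a x ⟩
    u * (a * x)         ≈⟨ *-congˡ ax≈ay ⟩
    u * (a * y)         ≈⟨ *-assoc u a y ⟨
    (u * a) * y         ≈⟨ *-congʳ (trans (*-comm u a) (*-inverseʳ a a≉0)) ⟩
    1# * y              ≈⟨ *-identityˡ y ⟩
    y                   ∎
    where u = inv a a≉0

  -- a t² = b s² forces a b = (b s / t)².
  square-ratio : ∀ {a b t s} → ¬ t ≈ 0# → a * (t * t) ≈ b * (s * s) → IsSquare (a * b)
  square-ratio {a} {b} {t} {s} t≉0 at²≈bs² = (b * s) * u , sym (begin
    a * b                                 ≈⟨ *-identityʳ (a * b) ⟨
    (a * b) * 1#                          ≈⟨ *-congˡ tu²≈1 ⟨
    (a * b) * ((t * u) * (t * u))         ≈⟨ regroup₁ a b t u ⟩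
    (b * (a * (t * t))) * (u * u)         ≈⟨ *-congʳ (*-congˡ at²≈bs²) ⟩
    (b * (b * (s * s))) * (u * u)         ≈⟨ regroup₂ b s u ⟩
    ((b * s) * u) * ((b * s) * u)         ∎)
    where
      u = inv t t≉0
      tu²≈1 : (t * u) * (t * u) ≈ 1#
      tu²≈1 = trans (*-cong (*-inverseʳ t t≉0) (*-inverseʳ t t≉0)) (*-identityʳ 1#)
      regroup₁ = solve 4 (λ a b t u → (a ⊕ b) ⊕ ((t ⊕ u) ⊕ (t ⊕ u))
                                     ⊜ (b ⊕ (a ⊕ (t ⊕ t))) ⊕ (u ⊕ u)) ≈-refl
      regroup₂ = solve 3 (λ b s u → (b ⊕ (b ⊕ (s ⊕ s))) ⊕ (u ⊕ u)
                                   ⊜ ((b ⊕ s) ⊕ u) ⊕ ((b ⊕ s) ⊕ u)) ≈-refl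

  square-cofactor : ∀ {t z} → ¬ t ≈ 0# → IsSquare ((t * t) * z) → IsSquare z
  square-cofactor {t} {z} t≉0 (s , s²≈t²z) =
    IsSquare-resp (*-identityʳ z) (square-ratio t≉0 zt²≈1s²)
    where
      zt²≈1s² : z * (t * t) ≈ 1# * (s * s)
      zt²≈1s² = trans (*-comm z (t * t)) (trans (sym s²≈t²z) (sym (*-identityˡ (s * s))))

  module WithDecidableEquality (_≟_ : Decidable _≈_) where

    zero-product : ∀ {x y} → x * y ≈ 0# → x ≈ 0# ⊎ y ≈ 0#
    zero-product {x} {y} xy≈0 with x ≟ 0#
    ... | yes x≈0 = inj₁ x≈0
    ... | no x≉0  = inj₂ (*-cancelˡ x≉0 (trans xy≈0 (sym (zeroʳ x))))

    *-nonzero : ∀ {x y} → ¬ x ≈ 0# → ¬ y ≈ 0# → ¬ x * y ≈ 0#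
    *-nonzero x≉0 y≉0 xy≈0 = [ x≉0 , y≉0 ]′ (zero-product xy≈0)

    square-roots : ∀ {t s} → t * t ≈ s * s → t ≈ s ⊎ t ≈ - s
    square-roots {t} {s} t²≈s² with zero-product {t + s} {t - s} difference-of-squares
      where
        [t+s]t≈[t+s]s : (t + s) * t ≈ (t + s) * s
        [t+s]t≈[t+s]s = begin
          (t + s) * t     ≈⟨ distribʳ t t s ⟩
          t * t + s * t   ≈⟨ +-cong t²≈s² (*-comm s t) ⟩
          s * s + t * s   ≈⟨ +-comm (s * s) (t * s) ⟩
          t * s + s * s   ≈⟨ distribʳ s t s ⟨
          (t + s) * s     ∎
        difference-of-squares : (t + s) * (t - s) ≈ 0#
        difference-of-squares =
          trans (x[y-z]≈xy-xz (t + s) t s) (x≈y⇒x∙y⁻¹≈ε [t+s]t≈[t+s]s)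
    ... | inj₁ t+s≈0 = inj₂ (inverseˡ-unique t s t+s≈0)
    ... | inj₂ t-s≈0 = inj₁ (x∙y⁻¹≈ε⇒x≈y t s t-s≈0)

    injective⇒nonzero-except-one : ∀ {k} (v : Fin (suc k) → Carrier) → (∀ i j → v i ≈ v j → i ≡ j)
      → ∃[ z ] (∀ i → i ≢ z → ¬ v i ≈ 0#)
    injective⇒nonzero-except-one v v-injective with Fin.any? (λ i → v i ≟ 0#)
    ... | yes (z , vz≈0) = z , λ i i≢z vi≈0 → i≢z (v-injective i z (trans vi≈0 (sym vz≈0)))
    ... | no no-zero     = zero , λ i _ vi≈0 → no-zero (i , vi≈0)

module FiniteField {c ℓ} (K : Field c ℓ) {N : ℕ} (card : HasCard K N) where
  open Field K renaming (refl to ≈-refl; zero to *-zero)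
  open FieldProperties K
  open AbelianGroupProperties +-abelianGroup using (⁻¹-involutive)

  element : Fin N → Carrier
  element = proj₁ card

  element-injective : ∀ i j → element i ≈ element j → i ≡ j
  element-injective = proj₁ (proj₂ card)

  index : Carrier → Fin N
  index x = proj₁ (proj₂ (proj₂ card) x)

  element-index : ∀ x → element (index x) ≈ x
  element-index x = proj₂ (proj₂ (proj₂ card) x)

  index-cong : ∀ {x y} → x ≈ y → index x ≡ index y
  index-cong {x} {y} x≈y =
    element-injective _ _ (trans (element-index x) (trans x≈y (sym (element-index y))))

  index-injective : ∀ {x y} → index x ≡ index y → x ≈ y
  index-injective {x} {y} eq =
    trans (sym (element-index x)) (trans (reflexive (cong element eq)) (element-index y))

  infix 4 _≟_
  _≟_ : Decidable _≈_
  x ≟ y with index x Fin.≟ index y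
  ... | yes eq = yes (index-injective eq)
  ... | no neq = no (neq ∘ index-cong)

  open WithDecidableEquality _≟_ public

  -- Tells t and -t apart (when they differ) by their order in the enumeration.
  sign : Carrier → Bool
  sign t = does (index t Fin.≤? index (- t))

  sign-cong : ∀ {t s} → t ≈ s → sign t ≡ sign s
  sign-cong t≈s = cong₂ (λ i j → does (i Fin.≤? j)) (index-cong t≈s) (index-cong (-‿cong t≈s))

  sign-neg : ∀ {t} → ¬ t ≈ - t → sign t ≢ sign (- t)
  sign-neg {t} t≉-t same = ≤?-flip (t≉-t ∘ index-injective) (≡-trans same sign-[-t])
    where
      sign-[-t] : sign (- t) ≡ does (index (- t) Fin.≤? index t)
      sign-[-t] = cong (λ j → does (index (- t) Fin.≤? j)) (index-cong (⁻¹-involutive t))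

  square-root-by-sign : ∀ {t s} → t * t ≈ s * s → sign t ≡ sign s → t ≈ s
  square-root-by-sign {t} {s} t²≈s² same with square-roots t²≈s²
  ... | inj₁ t≈s = t≈s
  ... | inj₂ t≈-s with t ≟ - t
  ...   | yes t≈-t = trans t≈-t (sym (neg-swap t≈-s))
  ...   | no t≉-t  = ⊥-elim (sign-neg t≉-t (≡-trans same (sign-cong (neg-swap t≈-s))))

  -- (t, k) ↦ (c k t², sign t) is injective on nonzero t, and the zero elements
  -- contribute only m further values: hence N m ≤ 2 N + m.
  module SquareClasses {m} (c : Fin m → Carrier) (c≉0 : ∀ k → ¬ c k ≈ 0#)
                       (distinct : ∀ k l → k ≢ l → ¬ IsSquare (c k * c l)) where

    same-class : ∀ {k l t s} → ¬ t ≈ 0# → c k * (t * t) ≈ c l * (s * s) → k ≡ l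
    same-class {k} {l} t≉0 eq with k Fin.≟ l
    ... | yes k≡l = k≡l
    ... | no k≢l  = ⊥-elim (distinct k l k≢l (square-ratio t≉0 eq))

    classify : (a : Fin N) → Dec (element a ≈ 0#) → Fin m → (Fin N × Bool) ⊎ Fin m
    classify a (yes _) k = inj₂ k
    classify a (no _)  k = inj₁ (index (c k * (element a * element a)) , sign (element a))

    classify-injective : ∀ a b k l da db → classify a da k ≡ classify b db l → (a , k) ≡ (b , l)
    classify-injective a b k l (yes a≈0) (yes b≈0) eq
      with element-injective a b (trans a≈0 (sym b≈0)) | inj₂-injective eq
    ... | refl | refl = refl
    classify-injective a b k l (yes _) (no _) ()
    classify-injective a b k l (no _) (yes _) ()
    classify-injective a b k l (no a≉0) (no _) eq
      with ,-injective (inj₁-injective eq)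
    ... | same-value , same-sign with same-class a≉0 (index-injective same-value)
    ...   | refl = cong (_, k) (element-injective a b (square-root-by-sign t²≈s² same-sign))
      where t²≈s² = *-cancelˡ (c≉0 k) (index-injective same-value)

    encode : Fin N × Fin m → (Fin N × Bool) ⊎ Fin m
    encode (a , k) = classify a (element a ≟ 0#) k

    encode-injective : Injective _≡_ _≡_ encode
    encode-injective {a , k} {b , l} = classify-injective a b k l _ _

    bound : N ℕ.* m ≤ N ℕ.* 2 ℕ.+ m
    bound = Fin.injective⇒≤ (Injection.injective embedding)
      where
        codomain : Fin (N ℕ.* 2 ℕ.+ m) ↔ ((Fin N × Bool) ⊎ Fin m)
        codomain = (((↔-refl ×-↔ Fin.2↔Bool) ↔-∘ Fin.*↔×) ⊎-↔ ↔-refl) ↔-∘ Fin.+↔⊎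
        embedding : Fin (N ℕ.* m) ↣ Fin (N ℕ.* 2 ℕ.+ m)
        embedding = ↔⇒↣ (↔-sym codomain) ↣-∘ (mk↣ encode-injective ↣-∘ ↔⇒↣ Fin.*↔×)

  three-square-classes⇒≤3 : (c : Fin 3 → Carrier) → (∀ k → ¬ c k ≈ 0#)
    → (∀ k l → k ≢ l → ¬ IsSquare (c k * c l)) → N ≤ 3
  three-square-classes⇒≤3 c c≉0 distinct = ℕ.+-cancelʳ-≤ (N ℕ.* 2) N 3 N+2N≤3+2N
    where
      N+2N≤3+2N : N ℕ.+ N ℕ.* 2 ≤ 3 ℕ.+ N ℕ.* 2
      N+2N≤3+2N = subst₂ _≤_ (ℕ.*-suc N 2) (ℕ.+-comm (N ℕ.* 2) 3) (SquareClasses.bound c c≉0 distinct)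

module Cliques {c ℓ r} (K : Field c ℓ) {U : Pred (Field.Carrier K) r}
               (U-resp : ∀ {x y} → Field._≈_ K x y → U x → U y) where
  open Field K renaming (refl to ≈-refl; zero to *-zero)

  clique-nil : IsClique K U 0 []
  clique-nil = (λ ()) , (λ ())

  clique-cons : ∀ {k v z} → IsClique K U k v → (∀ i → ¬ z ≈ v i) → (∀ i → U (z * v i))
    → IsClique K U (suc k) (z ∷ v)
  clique-cons {v = v} {z} (v-injective , v-adjacent) z≉v z-adjacent = injective , adjacent
    where
      injective : ∀ i j → (z ∷ v) i ≈ (z ∷ v) j → i ≡ j
      injective zero    zero    _ = refl
      injective zero    (suc j) e = ⊥-elim (z≉v j e)
      injective (suc i) zero    e = ⊥-elim (z≉v i (sym e))
      injective (suc i) (suc j) e = cong suc (v-injective i j e)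
      adjacent : ∀ i j → i ≢ j → U ((z ∷ v) i * (z ∷ v) j)
      adjacent zero    zero    i≢j = ⊥-elim (i≢j refl)
      adjacent zero    (suc j) _   = z-adjacent j
      adjacent (suc i) zero    _   = U-resp (*-comm z (v i)) (z-adjacent i)
      adjacent (suc i) (suc j) i≢j = v-adjacent i j (i≢j ∘ cong suc)

  triangle : ∀ a b d → ¬ a ≈ b → ¬ a ≈ d → ¬ b ≈ d → U (a * b) → U (a * d) → U (b * d)
    → CliqueNumber≥ K U 3
  triangle a b d a≉b a≉d b≉d ab∈U ad∈U bd∈U = a ∷ b ∷ d ∷ [] ,
    clique-cons (clique-cons (clique-cons clique-nil (λ ()) (λ ()))
                             (λ { zero → b≉d }) (λ { zero → bd∈U }))
                (λ { zero → a≉b ; (suc zero) → a≉d }) (λ { zero → ab∈U ; (suc zero) → ad∈U })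

module SubspaceGraph {c ℓ p r} (K : Field c ℓ) {N : ℕ} (card : HasCard K N)
                     {F : Pred (Field.Carrier K) p} (isF : IsSubfield K F)
                     {U : Pred (Field.Carrier K) r} (isU : IsSubspace K F U) where
  open Field K renaming (refl to ≈-refl; zero to *-zero)
  open FieldProperties K
  open FiniteField K card
  open IsSubfield isF using () renaming (has0 to F-0; has1 to F-1; neg-cl to F-neg; *-cl to F-*)
  open IsSubspace isU using (smul-cl) renaming (resp to U-resp; has0 to U-0)
  open Cliques K U-resp
  open import Relation.Binary.Reasoning.Setoid setoid
  open AbelianGroupProperties +-abelianGroup using (⁻¹-involutive; ε⁻¹≈ε)
  open RingProperties ring using (-‿distribˡ-*)
  open CommutativeMonoidSolver *-commutativeMonoid using (solve; _⊜_; _⊕_)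

  0*∈U : ∀ z → U (0# * z)
  0*∈U z = U-resp (sym (zeroˡ z)) U-0

  -- For x ∉ U we have x ≠ x⁻¹, since x² = 1 would give x = ±1 ∈ U.
  proper⇒clique₃ : Proper K U → ∀ {u} → U u → ¬ u ≈ 0# → CliqueNumber≥ K U 3
  proper⇒clique₃ (x , x∉U) {u} u∈U u≉0 with u ≟ 1#
  ... | no u≉1 = triangle 0# 1# u (1≉0 ∘ sym) (u≉0 ∘ sym) (u≉1 ∘ sym)
                   (0*∈U 1#) (0*∈U u) (U-resp (sym (*-identityˡ u)) u∈U)
  ... | yes u≈1 = triangle 0# x y (x≉0 ∘ sym) (inv-nonzero x x≉0 ∘ sym) x≉y
                   (0*∈U x) (0*∈U y) (U-resp (sym (*-inverseʳ x x≉0)) 1∈U)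
    where
      1∈U : U 1#
      1∈U = U-resp u≈1 u∈U
      x≉0 : ¬ x ≈ 0#
      x≉0 x≈0 = x∉U (U-resp (sym x≈0) U-0)
      y = inv x x≉0
      x≉y : ¬ x ≈ y
      x≉y x≈y with square-roots (trans (trans (*-congˡ x≈y) (*-inverseʳ x x≉0)) (sym (*-identityʳ 1#)))
      ... | inj₁ x≈1  = x∉U (U-resp (sym x≈1) 1∈U)
      ... | inj₂ x≈-1 = x∉U (U-resp (trans (*-identityʳ (- 1#)) (sym x≈-1)) (smul-cl (F-neg F-1) 1∈U))

  Independent : ∀ {d} → (Fin d → Carrier) → Set (c ⊔ ℓ ⊔ p)
  Independent bs = ∀ cs → (∀ i → F (cs i)) → lincomb K cs bs ≈ 0# → ∀ i → cs i ≈ 0#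

  lincomb-zero : ∀ {d} (cs bs : Fin d → Carrier) → (∀ i → cs i ≈ 0#) → lincomb K cs bs ≈ 0#
  lincomb-zero {zero}  cs bs cs≈0 = ≈-refl
  lincomb-zero {suc d} cs bs cs≈0 = begin
    cs zero * bs zero + lincomb K (cs ∘ suc) (bs ∘ suc)
      ≈⟨ +-cong (trans (*-congʳ (cs≈0 zero)) (zeroˡ (bs zero)))
                (lincomb-zero (cs ∘ suc) (bs ∘ suc) (cs≈0 ∘ suc)) ⟩
    0# + 0#
      ≈⟨ +-identityˡ 0# ⟩
    0# ∎

  independent⇒nonzero : ∀ {d} (bs : Fin (suc d) → Carrier) → Independent bs → ¬ bs zero ≈ 0#
  independent⇒nonzero bs bs-independent bs₀≈0 = 1≉0 (bs-independent cs cs∈F relation zero)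
    where
      cs = 1# ∷ (λ _ → 0#)
      cs∈F : ∀ k → F (cs k)
      cs∈F zero    = F-1
      cs∈F (suc _) = F-0
      relation : lincomb K cs bs ≈ 0#
      relation = trans (+-cong (trans (*-identityˡ (bs zero)) bs₀≈0)
                               (lincomb-zero _ (bs ∘ suc) (λ _ → ≈-refl)))
                       (+-identityˡ 0#)

  module Line {q} (F-card : SubsetCard K F q) where
    g : Fin q → Carrier
    g = proj₁ F-card

    g∈F : ∀ i → F (g i)
    g∈F = proj₁ (proj₂ F-card)

    g-injective : ∀ i j → g i ≈ g j → i ≡ j
    g-injective = proj₁ (proj₂ (proj₂ F-card))

    OnLine : Carrier → Carrier → Set ℓ
    OnLine s w = ∃[ i ] w ≈ g i * s

    OnLine? : ∀ s w → Dec (OnLine s w)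
    OnLine? s w = Fin.any? (λ i → w ≟ g i * s)

    independent⇒not-collinear : ∀ {d s} (bs : Fin (suc (suc d)) → Carrier) → Independent bs
      → OnLine s (bs zero) → ¬ OnLine s (bs (suc zero))
    independent⇒not-collinear {s = s} bs bs-independent (i , bs₀≈αs) (j , bs₁≈βs) =
      independent⇒nonzero bs bs-independent (trans bs₀≈αs (trans (*-congʳ α≈0) (zeroˡ s)))
      where
        α = g i
        β = g j
        cs = β ∷ (- α) ∷ (λ _ → 0#)
        cs∈F : ∀ k → F (cs k)
        cs∈F zero          = g∈F j
        cs∈F (suc zero)    = F-neg (g∈F i)
        cs∈F (suc (suc _)) = F-0
        relation : lincomb K cs bs ≈ 0#
        relation = begin
          β * bs zero + ((- α) * bs (suc zero) + lincomb K (λ _ → 0#) (λ k → bs (suc (suc k))))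
            ≈⟨ +-cong (*-congˡ bs₀≈αs)
                      (+-cong (*-congˡ bs₁≈βs) (lincomb-zero _ (λ k → bs (suc (suc k))) (λ _ → ≈-refl))) ⟩
          β * (α * s) + ((- α) * (β * s) + 0#)
            ≈⟨ +-congˡ (trans (+-identityʳ _) (sym (-‿distribˡ-* α (β * s)))) ⟩
          β * (α * s) - α * (β * s)
            ≈⟨ +-congˡ (-‿cong (solve 3 (λ a b s → a ⊕ (b ⊕ s) ⊜ b ⊕ (a ⊕ s)) ≈-refl α β s)) ⟩
          β * (α * s) - β * (α * s)
            ≈⟨ -‿inverseʳ _ ⟩
          0# ∎
        α≈0 : α ≈ 0#
        α≈0 = trans (sym (⁻¹-involutive α)) (trans (-‿cong (bs-independent cs cs∈F relation (suc zero))) ε⁻¹≈ε)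

    independent⇒off-line : ∀ {d} (bs : Fin (suc (suc d)) → Carrier) → (∀ i → U (bs i)) → Independent bs
      → ∀ s → ∃[ w ] (U w × ¬ OnLine s w)
    independent⇒off-line bs bs∈U bs-independent s
      with OnLine? s (bs zero) | OnLine? s (bs (suc zero))
    ... | no off  | _       = bs zero , bs∈U zero , off
    ... | yes _   | no off  = bs (suc zero) , bs∈U (suc zero) , off
    ... | yes on₀ | yes on₁ = ⊥-elim (independent⇒not-collinear bs bs-independent on₀ on₁)

    line-clique : ∀ {b} → ¬ b ≈ 0# → U (b * b) → IsClique K U q (λ i → b * g i)
    line-clique {b} b≉0 b²∈U = (λ i j e → g-injective i j (*-cancelˡ b≉0 e)) , adjacent
      where
        adjacent : ∀ i j → i ≢ j → U ((b * g i) * (b * g j))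
        adjacent i j _ = U-resp (solve 3 (λ x y b → (x ⊕ y) ⊕ (b ⊕ b) ⊜ (b ⊕ x) ⊕ (b ⊕ y)) ≈-refl (g i) (g j) b)
                                (smul-cl (F-* (g∈F i) (g∈F j)) b²∈U)

    off-line-clique : ∀ {b w} → ¬ b ≈ 0# → U (b * b) → U w → ¬ OnLine (b * b) w
      → CliqueNumber≥ K U (suc q)
    off-line-clique {b} {w} b≉0 b²∈U w∈U w-off =
      z ∷ (λ i → b * g i) , clique-cons (line-clique b≉0 b²∈U) z≉bg z-adjacent
      where
        z = w * inv b b≉0
        bz≈w : b * z ≈ w
        bz≈w = begin
          b * (w * inv b b≉0)   ≈⟨ solve 3 (λ b w u → b ⊕ (w ⊕ u) ⊜ w ⊕ (b ⊕ u)) ≈-refl b w (inv b b≉0) ⟩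
          w * (b * inv b b≉0)   ≈⟨ *-congˡ (*-inverseʳ b b≉0) ⟩
          w * 1#                ≈⟨ *-identityʳ w ⟩
          w                     ∎
        z≉bg : ∀ i → ¬ z ≈ b * g i
        z≉bg i z≈bgᵢ = w-off (i , (begin
          w               ≈⟨ bz≈w ⟨
          b * z           ≈⟨ *-congˡ z≈bgᵢ ⟩
          b * (b * g i)   ≈⟨ solve 2 (λ b x → b ⊕ (b ⊕ x) ⊜ x ⊕ (b ⊕ b)) ≈-refl b (g i) ⟩
          g i * (b * b)   ∎))
        z-adjacent : ∀ i → U (z * (b * g i))
        z-adjacent i = U-resp gᵢw≈z[bgᵢ] (smul-cl (g∈F i) w∈U)
          where
            gᵢw≈z[bgᵢ] : g i * w ≈ z * (b * g i)
            gᵢw≈z[bgᵢ] = begin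
              g i * w         ≈⟨ *-congˡ bz≈w ⟨
              g i * (b * z)   ≈⟨ solve 3 (λ x b z → x ⊕ (b ⊕ z) ⊜ z ⊕ (b ⊕ x)) ≈-refl (g i) b z ⟩
              z * (b * g i)   ∎

    square⇒clique : HasNonzeroSquare K U → ∀ {d} (bs : Fin (suc d) → Carrier)
      → (∀ i → U (bs i)) → Independent bs → CliqueNumber≥ K U (q ℕ.+ (1 ⊓ d))
    square⇒clique (b , b≉0 , b²∈U) {zero} _ _ _ =
      subst (CliqueNumber≥ K U) (≡-sym (ℕ.+-identityʳ q)) (_ , line-clique b≉0 b²∈U)
    square⇒clique (b , b≉0 , b²∈U) {suc d} bs bs∈U bs-independent
      with independent⇒off-line bs bs∈U bs-independent (b * b)
    ... | w , w∈U , w-off = subst (CliqueNumber≥ K U) (ℕ.+-comm 1 q) (off-line-clique b≉0 b²∈U w∈U w-off)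

  module NoSquares (no-square : ¬ HasNonzeroSquare K U) where

    nonzero⇒nonsquare : ∀ {z} → U z → ¬ z ≈ 0# → ¬ IsSquare z
    nonzero⇒nonsquare {z} z∈U z≉0 (s , s²≈z) = no-square (s , s≉0 , U-resp (sym s²≈z) z∈U)
      where
        s≉0 : ¬ s ≈ 0#
        s≉0 s≈0 = z≉0 (trans (sym s²≈z) (trans (*-congʳ s≈0) (zeroˡ s)))

    no-nonzero-triangle : 3 < N → (w : Fin 3 → Carrier) → (∀ i → ¬ w i ≈ 0#)
      → (∀ i j → i ≢ j → U (w i * w j)) → ⊥
    no-nonzero-triangle 3<N w w≉0 w-adjacent =
      ℕ.<⇒≱ 3<N (three-square-classes⇒≤3 edge edge≉0 edge-products)
      where
        w₀ = w zero
        w₁ = w (suc zero)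
        w₂ = w (suc (suc zero))
        edge : Fin 3 → Carrier
        edge = (w₁ * w₂) ∷ (w₀ * w₂) ∷ (w₀ * w₁) ∷ []
        edge∈U : ∀ k → U (edge k)
        edge∈U zero             = w-adjacent (suc zero) (suc (suc zero)) (λ ())
        edge∈U (suc zero)       = w-adjacent zero (suc (suc zero)) (λ ())
        edge∈U (suc (suc zero)) = w-adjacent zero (suc zero) (λ ())
        edge≉0 : ∀ k → ¬ edge k ≈ 0#
        edge≉0 zero             = *-nonzero (w≉0 (suc zero)) (w≉0 (suc (suc zero)))
        edge≉0 (suc zero)       = *-nonzero (w≉0 zero) (w≉0 (suc (suc zero)))
        edge≉0 (suc (suc zero)) = *-nonzero (w≉0 zero) (w≉0 (suc zero))
        through : ∀ k l m → edge k * edge l ≈ (w m * w m) * edge m → ¬ IsSquare (edge k * edge l)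
        through _ _ m eq square =
          nonzero⇒nonsquare (edge∈U m) (edge≉0 m) (square-cofactor (w≉0 m) (IsSquare-resp eq square))
        edge-products : ∀ k l → k ≢ l → ¬ IsSquare (edge k * edge l)
        edge-products zero zero k≢l = ⊥-elim (k≢l refl)
        edge-products zero (suc zero) _ =
          through zero (suc zero) (suc (suc zero)) (solve 3 (λ a b c → (b ⊕ c) ⊕ (a ⊕ c) ⊜ (c ⊕ c) ⊕ (a ⊕ b)) ≈-refl w₀ w₁ w₂)
        edge-products zero (suc (suc zero)) _ =
          through zero (suc (suc zero)) (suc zero) (solve 3 (λ a b c → (b ⊕ c) ⊕ (a ⊕ b) ⊜ (b ⊕ b) ⊕ (a ⊕ c)) ≈-refl w₀ w₁ w₂)
        edge-products (suc zero) (suc (suc zero)) _ =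
          through (suc zero) (suc (suc zero)) zero (solve 3 (λ a b c → (a ⊕ c) ⊕ (a ⊕ b) ⊜ (a ⊕ a) ⊕ (b ⊕ c)) ≈-refl w₀ w₁ w₂)
        edge-products (suc zero) zero k≢l =
          edge-products zero (suc zero) (k≢l ∘ ≡-sym) ∘ IsSquare-resp (*-comm _ _)
        edge-products (suc (suc zero)) zero k≢l =
          edge-products zero (suc (suc zero)) (k≢l ∘ ≡-sym) ∘ IsSquare-resp (*-comm _ _)
        edge-products (suc (suc zero)) (suc zero) k≢l =
          edge-products (suc zero) (suc (suc zero)) (k≢l ∘ ≡-sym) ∘ IsSquare-resp (*-comm _ _)
        edge-products (suc zero) (suc zero) k≢l = ⊥-elim (k≢l refl)
        edge-products (suc (suc zero)) (suc (suc zero)) k≢l = ⊥-elim (k≢l refl)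

    no-4-clique : 3 < N → ¬ CliqueNumber≥ K U 4
    no-4-clique 3<N (v , v-injective , v-adjacent) with injective⇒nonzero-except-one v v-injective
    ... | z , v≉0 = no-nonzero-triangle 3<N (v ∘ punchIn z)
      (λ i → v≉0 (punchIn z i) (Fin.punchInᵢ≢i z i))
      (λ i j i≢j → v-adjacent (punchIn z i) (punchIn z j) (i≢j ∘ Fin.punchIn-injective z i j))

open import Data.Nat using (_+_)

lemma3p3 : ∀ {c ℓ p r : Level} (K : Field c ℓ) (q n : ℕ)
    → IsPrimePower q → 2 ≤ n → HasCard K (q ^ n)
    → (F : Pred (Field.Carrier K) p) → IsSubfield K F → SubsetCard K F q
    → (U : Pred (Field.Carrier K) r) → IsSubspace K F U → Proper K U
    → (d : ℕ) → HasDim K F U d → 1 ≤ d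
    → CliqueNumber≥ K U 3
      × (HasNonzeroSquare K U → CliqueNumber≥ K U (q + (1 ⊓ (d ∸ 1))))
      × (¬ HasNonzeroSquare K U → CliqueNumber≡ K U 3)
lemma3p3 K q n q-prime-power 2≤n card F isF F-card U isU U-proper (suc d) (bs , bs∈U , bs-independent , _) _ =
  clique₃ ,
  (λ square → Line.square⇒clique F-card square bs bs∈U bs-independent) ,
  (λ no-square → clique₃ , NoSquares.no-4-clique no-square 3<q^n)
  where
    open SubspaceGraph K card isF isU
    clique₃ : CliqueNumber≥ K U 3
    clique₃ = proper⇒clique₃ U-proper (bs∈U zero) (independent⇒nonzero bs bs-independent)
    3<q^n : 3 < q ^ n
    3<q^n = 4≤m^n (primePower⇒2≤ q-prime-power) 2≤n
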